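{- For every integer $n\ge 3$, $$PG(3n-1,2n-1)=p(n)-1$$ and $$PG(3n-2,2n-2)=PG(3n-3,2n-3)=p(n)-2.$$
   Context: A partition $\lambda=(\lambda_1\ge\cdots\ge\lambda_\ell)$ of $n$ is a finite nonincreasing sequence of positive integers with sum $n$; $\ell(\lambda)$ is its number of parts; $p(N)$ is the number of partitions of $N$. The hook length $h_{(i,j)}(\lambda)$ of a cell $(i,j)$ of the Ferrers diagram is the number of cells consisting of the cell itself, the cells to its right in its row and the cells below it in its column. A numerical set is a subset $S\subseteq\mathbb{N}_0$ containing $0$ with finite complement; a numerical semigroup is a numerical set closed under addition. For a partition $\lambda$ let $S_\lambda=\mathbb{N}_0\setminus\{h_{(i,1)}(\lambda):1\le i\le\ell(\lambda)\}$. $PG(n,g)$ is the number of partitions $\lambda$ of $n$ with exactly $g$ parts such that $S_\lambda$ is a numerical semigroup. -}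

module Defs where

open import Data.Nat using (ℕ; zero; suc; _+_; _∸_; _≤_; _<_; _≥_; _≤?_)
open import Data.List using (List; []; _∷_; length; filter; drop)
open import Data.Nat.ListAction using (sum)
open import Data.List.Relation.Unary.All using (All)
open import Data.List.Relation.Unary.Linked using (Linked)
open import Data.List.Relation.Unary.Unique.Propositional using (Unique)
open import Data.List.Membership.Propositional using (_∈_)
open import Data.Product using (Σ; _×_; ∃)
open import Relation.Binary.PropositionalEquality using (_≡_)
open import Relation.Nullary using (¬_)
open import Function.Bundles using (_⇔_)

IsPartitionOf : ℕ → List ℕ → Set
IsPartitionOf n la = All (λ x → 0 < x) la × Linked _≥_ la × sum la ≡ n

ℓ : List ℕ → ℕ
ℓ = length

-- part λ i = λ_i (1-indexed); 0 outside 1 ≤ i ≤ ℓ(λ)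
part : List ℕ → ℕ → ℕ
part []       _             = 0
part (x ∷ xs) zero          = 0
part (x ∷ xs) (suc zero)    = x
part (x ∷ xs) (suc (suc i)) = part xs (suc i)

-- hook length of cell (i , j) (1-indexed row i, column j) of the Ferrers
-- diagram: the cell itself, the cells to its right in row i (λ_i - j of them),
-- and the cells below it in column j (rows k > i with λ_k ≥ j).
hook : List ℕ → ℕ → ℕ → ℕ
hook la i j = suc ((part la i ∸ j) + length (filter (λ x → j ≤? x) (drop i la)))

Sλ : List ℕ → ℕ → Set
Sλ la s = ¬ (Σ ℕ (λ i → (1 ≤ i) × (i ≤ ℓ la) × (hook la i 1 ≡ s)))

IsNumericalSet : (ℕ → Set) → Set
IsNumericalSet S = S 0 × ∃ (λ b → ∀ x → b ≤ x → S x)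

IsNumericalSemigroup : (ℕ → Set) → Set
IsNumericalSemigroup S = IsNumericalSet S × (∀ x y → S x → S y → S (x + y))

IsPG : ℕ → ℕ → List ℕ → Set
IsPG n g la = IsPartitionOf n la × ℓ la ≡ g × IsNumericalSemigroup (Sλ la)

-- "exactly k lists satisfy P": a duplicate-free list enumerating P, of length k
HasCount : (List ℕ → Set) → ℕ → Set
HasCount P k = Σ (List (List ℕ)) (λ L → Unique L × (∀ la → (la ∈ L) ⇔ P la) × length L ≡ k)

-- Removing the first column is a bijection between the partitions λ of n + g with g parts
-- and the partitions μ of n (as n ≤ g); write λ = (μ₁ + 1, …, μ_ℓ + 1, 1^r), r = g − ℓ(μ).
-- The first-column hooks of λ include 1, …, r and are at most μ₁ + ℓ(μ) + r, so S_λ is a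
-- numerical semigroup whenever μ₁ + 2ℓ(μ) ≤ g + 1.  For g ≥ 2n − 3 this bound fails only for
-- the hook partitions μ = (a, 1^(n−a)) with a ≤ 2n − g ≤ 3, whose hooks are explicit: r + 1 ∈ S_λ
-- while 2r + 2 is a hook, except for a = 2, g = 2n − 3, where S_λ is nevertheless a semigroup.
-- Hence exactly one partition of n is lost for g = 2n − 1, and two for g = 2n − 2, 2n − 3.

module Submission where

open import Defs
open import Data.Nat
  using (ℕ; zero; suc; pred; _+_; _*_; _∸_; _≤_; _<_; _≥_; _≤?_; _≟_; z≤n; s≤s; s≤s⁻¹)
open import Data.Nat.Properties
open import Data.Nat.Tactic.RingSolver using (solve)
open import Data.Nat.ListAction using (sum)
open import Data.List using (List; []; _∷_; length; filter; map; _++_; replicate; applyDownFrom)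
import Data.List as List
open import Data.List.Properties
  using (length-++; length-map; length-replicate; map-replicate;
         filter-all; filter-accept; filter-reject; ≡-dec)
open import Data.List.Relation.Unary.All using (All; []; _∷_)
import Data.List.Relation.Unary.All as All
import Data.List.Relation.Unary.All.Properties as All
open import Data.List.Relation.Unary.AllPairs using ([]; _∷_)
open import Data.List.Relation.Unary.Any using (here; there)
open import Data.List.Relation.Unary.Linked using (Linked; []; [-]; _∷_)
import Data.List.Relation.Unary.Linked as Linked
import Data.List.Relation.Unary.Linked.Properties as Linked
open import Data.List.Relation.Unary.Unique.Propositional using (Unique)
import Data.List.Relation.Unary.Unique.Propositional.Properties as Unique
open import Data.List.Membership.Propositional using (_∈_; _∉_)
open import Data.List.Membership.Propositional.Properties
  using (∈-map⁺; ∈-map⁻; ∈-++⁺ˡ; ∈-++⁺ʳ; ∈-++⁻; ∈-applyDownFrom⁺; ∈-applyDownFrom⁻;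
         ∈-filter⁺; ∈-filter⁻)
open import Data.Product using (Σ; _×_; _,_; proj₁)
open import Data.Sum using (_⊎_; inj₁; inj₂)
import Data.Sum as Sum
open import Data.Empty using (⊥-elim)
open import Function using (_∘_; case_of_)
open import Function.Bundles using (_⇔_; mk⇔; Equivalence)
open import Function.Properties.Equivalence using () renaming (trans to ⇔-trans)
open import Relation.Binary.Definitions using (DecidableEquality)
open import Relation.Binary.PropositionalEquality
open import Relation.Nullary using (¬_; Dec; yes; no; ¬?)

open Equivalence using (to; from)
open ≤-Reasoning

Positive : List ℕ → Set
Positive = All (0 <_)

SemigroupPartition : List ℕ → Set
SemigroupPartition la = IsNumericalSemigroup (Sλ la)

IsFirstColumnHook : List ℕ → ℕ → Set
IsFirstColumnHook la s = Σ ℕ (λ i → (1 ≤ i) × (i ≤ ℓ la) × (hook la i 1 ≡ s))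

firstColumnHooks : List ℕ → List ℕ
firstColumnHooks []       = []
firstColumnHooks (y ∷ ys) = y + length ys ∷ firstColumnHooks ys

hook-1-1 : ∀ {y ys} → 0 < y → Positive ys → hook (y ∷ ys) 1 1 ≡ y + length ys
hook-1-1 {suc y} {ys} _ ys⁺ = cong (λ zs → suc (y + length zs)) (filter-all (1 ≤?_) ys⁺)

firstColumnHook⇒∈ : ∀ {la s} → Positive la → IsFirstColumnHook la s → s ∈ firstColumnHooks la
firstColumnHook⇒∈ _ (zero , () , _)
firstColumnHook⇒∈ {[]} _ (suc _ , _ , () , _)
firstColumnHook⇒∈ {y ∷ ys} (y⁺ ∷ ys⁺) (suc zero , _ , _ , refl) = here (hook-1-1 y⁺ ys⁺)
firstColumnHook⇒∈ {y ∷ ys} (_ ∷ ys⁺) (suc (suc i) , _ , s≤s i≤ℓ , eq) =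
  there (firstColumnHook⇒∈ ys⁺ (suc i , s≤s z≤n , i≤ℓ , eq))

∈⇒firstColumnHook : ∀ {la s} → Positive la → s ∈ firstColumnHooks la → IsFirstColumnHook la s
∈⇒firstColumnHook {y ∷ ys} (y⁺ ∷ ys⁺) (here refl) =
  1 , s≤s z≤n , s≤s z≤n , hook-1-1 y⁺ ys⁺
∈⇒firstColumnHook {y ∷ ys} (_ ∷ ys⁺) (there s∈) with ∈⇒firstColumnHook ys⁺ s∈
... | zero , () , _
... | suc i , _ , i≤ℓ , eq = suc (suc i) , s≤s z≤n , s≤s i≤ℓ , eq

∉⇒Sλ : ∀ {la s} → Positive la → s ∉ firstColumnHooks la → Sλ la s
∉⇒Sλ la⁺ s∉ = s∉ ∘ firstColumnHook⇒∈ la⁺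

∈⇒¬Sλ : ∀ {la s} → Positive la → s ∈ firstColumnHooks la → ¬ Sλ la s
∈⇒¬Sλ la⁺ s∈ s∈S = s∈S (∈⇒firstColumnHook la⁺ s∈)

Sλ-0 : ∀ la → Sλ la 0
Sλ-0 la (_ , _ , _ , ())

firstColumnHooks-++ : ∀ xs ys →
  firstColumnHooks (xs ++ ys) ≡ map (_+ length ys) (firstColumnHooks xs) ++ firstColumnHooks ys
firstColumnHooks-++ []       ys = refl
firstColumnHooks-++ (x ∷ xs) ys =
  cong₂ _∷_ (trans (cong (x +_) (length-++ xs)) (sym (+-assoc x (length xs) (length ys))))
            (firstColumnHooks-++ xs ys)

firstColumnHooks-replicate : ∀ p a → firstColumnHooks (replicate p a) ≡ applyDownFrom (a +_) p
firstColumnHooks-replicate zero    a = refl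
firstColumnHooks-replicate (suc p) a =
  cong₂ _∷_ (cong (a +_) (length-replicate p)) (firstColumnHooks-replicate p a)

firstColumnHooks-< : ∀ {b} la → All (_≤ b) la → All (_< b + length la) (firstColumnHooks la)
firstColumnHooks-< [] [] = []
firstColumnHooks-< {b} (y ∷ ys) (y≤b ∷ ys≤b) =
  subst (y + length ys <_) (sym (+-suc b (length ys))) (s≤s (+-monoˡ-≤ (length ys) y≤b))
  ∷ All.map (λ h< → <-≤-trans h< (+-monoʳ-≤ b (n≤1+n _))) (firstColumnHooks-< ys ys≤b)

-- Numerical sets whose first gaps form an interval

closure-from-nonzero : ∀ {S : ℕ → Set} → (∀ x y → 0 < x → 0 < y → S x → S y → S (x + y)) →
                       ∀ x y → S x → S y → S (x + y)
closure-from-nonzero h zero    y       _  Sy = Sy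
closure-from-nonzero {S} h (suc x) zero    Sx _  = subst S (sym (+-identityʳ (suc x))) Sx
closure-from-nonzero h (suc x) (suc y) Sx Sy = h _ _ (s≤s z≤n) (s≤s z≤n) Sx Sy

above-gaps : ∀ {S : ℕ → Set} {r} → (∀ x → 1 ≤ x → x ≤ r → ¬ S x) →
             ∀ {x} → 0 < x → S x → r < x
above-gaps {r = r} gaps {x} 0<x Sx with x ≤? r
... | yes x≤r = ⊥-elim (gaps x 0<x x≤r Sx)
... | no  x≰r = ≰⇒> x≰r

interval-gaps⇒numericalSemigroup : ∀ (S : ℕ → Set) r → S 0 →
  (∀ x → 1 ≤ x → x ≤ r → ¬ S x) → (∀ x → 2 + (r + r) ≤ x → S x) → IsNumericalSemigroup S
interval-gaps⇒numericalSemigroup S r S0 gaps large = (S0 , _ , large) , closure-from-nonzero sum∈S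
  where
  sum∈S : ∀ x y → 0 < x → 0 < y → S x → S y → S (x + y)
  sum∈S x y 0<x 0<y Sx Sy = large (x + y) (subst (_≤ x + y) (cong suc (+-suc r r))
    (+-mono-≤ (above-gaps gaps 0<x Sx) (above-gaps gaps 0<y Sy)))

-- Adding and removing the first column

pad : ℕ → List ℕ → List ℕ
pad r μ = map suc μ ++ replicate r 1

addColumn : ℕ → List ℕ → List ℕ
addColumn g μ = pad (g ∸ length μ) μ

removeColumn : List ℕ → List ℕ
removeColumn la = filter (1 ≤?_) (map pred la)

pad-positive : ∀ r μ → Positive (pad r μ)
pad-positive r μ =
  All.++⁺ (All.map⁺ (All.universal (λ _ → s≤s z≤n) μ)) (All.replicate⁺ r (s≤s z≤n))

pad-bounded : ∀ {b} r μ → All (_≤ b) μ → All (_≤ suc b) (pad r μ)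
pad-bounded r μ μ≤b = All.++⁺ (All.map⁺ (All.map s≤s μ≤b)) (All.replicate⁺ r (s≤s z≤n))

length-pad : ∀ r μ → length (pad r μ) ≡ length μ + r
length-pad r μ = trans (length-++ (map suc μ)) (cong₂ _+_ (length-map suc μ) (length-replicate r))

sum-ones : ∀ k → sum (replicate k 1) ≡ k
sum-ones zero    = refl
sum-ones (suc k) = cong suc (sum-ones k)

sum-pad : ∀ r μ → sum (pad r μ) ≡ sum μ + (length μ + r)
sum-pad r []      = sum-ones r
sum-pad r (x ∷ μ) = begin-equality
  suc x + sum (pad r μ)             ≡⟨ cong (suc x +_) (sum-pad r μ) ⟩
  suc (x + (sum μ + (length μ + r))) ≡⟨ cong suc (sym (+-assoc x (sum μ) _)) ⟩
  suc (x + sum μ + (length μ + r))   ≡⟨ sym (+-suc (x + sum μ) _) ⟩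
  x + sum μ + (suc (length μ) + r)   ∎

replicate-sorted : ∀ r {x} → Linked _≥_ (replicate r x)
replicate-sorted zero          = []
replicate-sorted (suc zero)    = [-]
replicate-sorted (suc (suc r)) = ≤-refl ∷ replicate-sorted (suc r)

pad-sorted : ∀ r {μ} → Linked _≥_ μ → Linked _≥_ (pad r μ)
pad-sorted r       []             = replicate-sorted r
pad-sorted zero    [-]            = [-]
pad-sorted (suc r) [-]            = s≤s z≤n ∷ replicate-sorted (suc r)
pad-sorted r       (x≥y ∷ sorted) = s≤s x≥y ∷ pad-sorted r sorted

sorted-bounded : ∀ {x xs} → Linked _≥_ (x ∷ xs) → All (_≤ x) (x ∷ xs)
sorted-bounded = Linked.Linked⇒All (λ x≥y y≥z → ≤-trans y≥z x≥y) ≤-refl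

length≤sum : ∀ {xs} → Positive xs → length xs ≤ sum xs
length≤sum [] = z≤n
length≤sum {suc x ∷ xs} (_ ∷ xs⁺) = s≤s (≤-trans (length≤sum xs⁺) (m≤n+m _ x))

≤1-ones : ∀ {xs} → Positive xs → All (_≤ 1) xs → xs ≡ replicate (length xs) 1
≤1-ones [] [] = refl
≤1-ones {suc zero ∷ xs} (_ ∷ xs⁺) (_ ∷ xs≤1) = cong (1 ∷_) (≤1-ones xs⁺ xs≤1)
≤1-ones {suc (suc _) ∷ _} _ (s≤s () ∷ _)

removeColumn-ones : ∀ r → removeColumn (replicate r 1) ≡ []
removeColumn-ones zero    = refl
removeColumn-ones (suc r) = removeColumn-ones r

removeColumn-pad : ∀ r {μ} → Positive μ → removeColumn (pad r μ) ≡ μ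
removeColumn-pad r []                  = removeColumn-ones r
removeColumn-pad r {suc x ∷ μ} (_ ∷ μ⁺) = cong (suc x ∷_) (removeColumn-pad r μ⁺)

addColumn-removeColumn : ∀ {la} → Positive la → Linked _≥_ la →
                         addColumn (length la) (removeColumn la) ≡ la
addColumn-removeColumn [] _ = refl
addColumn-removeColumn {suc zero ∷ la} (_ ∷ la⁺) sorted =
  trans (cong (addColumn _) (trans (cong removeColumn ones) (removeColumn-ones (length la))))
        (cong (1 ∷_) (sym ones))
  where
  ones : la ≡ replicate (length la) 1
  ones = ≤1-ones la⁺ (All.tail (sorted-bounded sorted))
addColumn-removeColumn {suc (suc x) ∷ la} (_ ∷ la⁺) sorted =
  cong (suc (suc x) ∷_) (addColumn-removeColumn la⁺ (Linked.tail sorted))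

sum-removeColumn : ∀ {la} → Positive la → sum (removeColumn la) + length la ≡ sum la
sum-removeColumn [] = refl
sum-removeColumn {suc zero ∷ la} (_ ∷ la⁺) = trans (+-suc _ _) (cong suc (sum-removeColumn la⁺))
sum-removeColumn {suc (suc x) ∷ la} (_ ∷ la⁺) =
  cong suc (trans (+-suc (x + _) _)
                  (cong suc (trans (+-assoc x _ _) (cong (x +_) (sum-removeColumn la⁺)))))

addColumn-isPartition : ∀ {n g μ} → IsPartitionOf n μ → length μ ≤ g →
                        IsPartitionOf (n + g) (addColumn g μ)
addColumn-isPartition {μ = μ} (μ⁺ , sorted , sum≡n) ℓ≤g =
  pad-positive _ μ , pad-sorted _ sorted , trans (sum-pad _ μ) (cong₂ _+_ sum≡n (m+[n∸m]≡n ℓ≤g))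

length-addColumn : ∀ {g μ} → length μ ≤ g → length (addColumn g μ) ≡ g
length-addColumn {μ = μ} ℓ≤g = trans (length-pad _ μ) (m+[n∸m]≡n ℓ≤g)

removeColumn-isPartition : ∀ {n g la} → IsPartitionOf (n + g) la → length la ≡ g →
                           IsPartitionOf n (removeColumn la)
removeColumn-isPartition {n} {g} {la} (la⁺ , sorted , sum≡) ℓ≡g =
  All.all-filter (1 ≤?_) (map pred la) ,
  Linked.filter⁺ (1 ≤?_) (λ x≥y y≥z → ≤-trans y≥z x≥y)
                 (Linked.map⁺ (Linked.map pred-mono-≤ sorted)) ,
  +-cancelʳ-≡ g _ _ (trans (cong (sum (removeColumn la) +_) (sym ℓ≡g))
                           (trans (sum-removeColumn la⁺) sum≡))

-- Hooks of λ = (μ₁ + 1, …, μ_ℓ + 1, 1^r)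

firstColumnHooks-pad : ∀ r μ →
  firstColumnHooks (pad r μ) ≡ map (_+ r) (firstColumnHooks (map suc μ)) ++ applyDownFrom suc r
firstColumnHooks-pad r μ = trans (firstColumnHooks-++ (map suc μ) (replicate r 1))
  (cong₂ (λ k hs → map (_+ k) (firstColumnHooks (map suc μ)) ++ hs)
         (length-replicate r) (firstColumnHooks-replicate r 1))

∈-pad-low : ∀ {r s} μ → 1 ≤ s → s ≤ r → s ∈ firstColumnHooks (pad r μ)
∈-pad-low {r} {suc s} μ _ s<r =
  subst (suc s ∈_) (sym (firstColumnHooks-pad r μ)) (∈-++⁺ʳ _ (∈-applyDownFrom⁺ suc s<r))

pad-large⇒Sλ : ∀ {b x} r μ → All (_≤ b) μ → suc b + (length μ + r) ≤ x → Sλ (pad r μ) x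
pad-large⇒Sλ {b} r μ μ≤b large = ∉⇒Sλ (pad-positive r μ) λ x∈ →
  <⇒≱ (All.lookup (firstColumnHooks-< (pad r μ) (pad-bounded r μ μ≤b)) x∈)
      (subst (λ k → suc b + k ≤ _) (sym (length-pad r μ)) large)

-- 1, …, r are hooks and every hook is below b + 1 + ℓ(μ) + r ≤ 2r + 2.
pad-semigroup : ∀ {b} r μ → All (_≤ b) μ → b + length μ ≤ suc r → SemigroupPartition (pad r μ)
pad-semigroup {b} r μ μ≤b fits = interval-gaps⇒numericalSemigroup (Sλ (pad r μ)) r (Sλ-0 _)
  (λ x 1≤x x≤r → ∈⇒¬Sλ (pad-positive r μ) (∈-pad-low μ 1≤x x≤r))
  (λ x large → pad-large⇒Sλ r μ μ≤b (≤-trans top≤ large))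
  where
  top≤ : suc b + (length μ + r) ≤ 2 + (r + r)
  top≤ = s≤s (subst (_≤ suc (r + r)) (+-assoc b (length μ) r) (+-monoˡ-≤ r fits))

padHook-hooks : ∀ a p r → firstColumnHooks (pad r (a ∷ replicate p 1)) ≡
  map (_+ r) (suc a + p ∷ applyDownFrom (2 +_) p) ++ applyDownFrom suc r
padHook-hooks a p r = trans (firstColumnHooks-pad r (a ∷ replicate p 1))
  (cong (λ hs → map (_+ r) hs ++ applyDownFrom suc r) hook-column)
  where
  hook-column : firstColumnHooks (map suc (a ∷ replicate p 1)) ≡ suc a + p ∷ applyDownFrom (2 +_) p
  hook-column = trans (cong (λ xs → firstColumnHooks (suc a ∷ xs)) (map-replicate suc p 1))
    (cong₂ _∷_ (cong (suc a +_) (length-replicate p)) (firstColumnHooks-replicate p 2))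

∈-padHook⁻ : ∀ {a p r s} → s ∈ firstColumnHooks (pad r (a ∷ replicate p 1)) →
  s ≡ suc a + p + r ⊎ Σ ℕ (λ j → j < p × s ≡ 2 + j + r) ⊎ s ≤ r
∈-padHook⁻ {a} {p} {r} {s} s∈
  with ∈-++⁻ (map (_+ r) _) (subst (s ∈_) (padHook-hooks a p r) s∈)
... | inj₂ low with _ , i<r , refl ← ∈-applyDownFrom⁻ suc low = inj₂ (inj₂ i<r)
... | inj₁ high with ∈-map⁻ (_+ r) {xs = suc a + p ∷ applyDownFrom (2 +_) p} high
...   | _ , here refl , refl = inj₁ refl
...   | _ , there mid , refl with j , j<p , refl ← ∈-applyDownFrom⁻ (2 +_) mid =
  inj₂ (inj₁ (j , j<p , refl))

padHook-top-∈ : ∀ a p r → suc a + p + r ∈ firstColumnHooks (pad r (a ∷ replicate p 1))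
padHook-top-∈ a p r =
  subst (suc a + p + r ∈_) (sym (padHook-hooks a p r)) (∈-++⁺ˡ {ys = applyDownFrom suc r} (here refl))

padHook-mid-∈ : ∀ {a p r j} → j < p → 2 + j + r ∈ firstColumnHooks (pad r (a ∷ replicate p 1))
padHook-mid-∈ {a} {p} {r} {j} j<p =
  subst (2 + j + r ∈_) (sym (padHook-hooks a p r))
    (∈-++⁺ˡ {ys = applyDownFrom suc r} (there (∈-map⁺ (_+ r) (∈-applyDownFrom⁺ (2 +_) j<p))))

padHook-semigroup : ∀ {a p r} → 1 ≤ a → a + p ≤ r → SemigroupPartition (pad r (a ∷ replicate p 1))
padHook-semigroup {a} {p} {r} 1≤a a+p≤r =
  pad-semigroup r _ (≤-refl ∷ All.replicate⁺ p 1≤a)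
    (subst (λ k → a + suc k ≤ suc r) (sym (length-replicate p))
           (subst (_≤ suc r) (sym (+-suc a p)) (s≤s a+p≤r)))

-- r + 1 is not a hook, but r + 1 + r + 1 is.
padHook-not-semigroup : ∀ {a p r} → 1 ≤ a → a + p ≡ suc r ⊎ r < p →
                        ¬ SemigroupPartition (pad r (a ∷ replicate p 1))
padHook-not-semigroup {suc a} {p} {r} _ top-or-mid (_ , closed) =
  ∈⇒¬Sλ la⁺ double∈ (closed (suc r) (suc r) r+1∈S r+1∈S)
  where
  la⁺ : Positive (pad r (suc a ∷ replicate p 1))
  la⁺ = pad-positive r (suc a ∷ replicate p 1)
  r+1∈S : Sλ (pad r (suc a ∷ replicate p 1)) (suc r)
  r+1∈S = ∉⇒Sλ la⁺ λ r+1∈ → case ∈-padHook⁻ r+1∈ of λ where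
    (inj₁ top)                  → m≢1+n+m r (cong pred top)
    (inj₂ (inj₁ (_ , _ , mid))) → m≢1+n+m r (cong pred mid)
    (inj₂ (inj₂ r+1≤r))         → n≮n r r+1≤r
  hooks : List ℕ
  hooks = firstColumnHooks (pad r (suc a ∷ replicate p 1))
  double∈ : suc r + suc r ∈ hooks
  double∈ = subst (_∈ hooks) (cong suc (sym (+-suc r r))) (case top-or-mid of λ where
    (inj₁ top) → subst (_∈ hooks) (cong (λ k → suc k + r) top) (padHook-top-∈ (suc a) p r)
    (inj₂ r<p) → padHook-mid-∈ r<p)

x+y≢3+q+q : ∀ {q x y} → q < x → q < y → x ≢ 2 + q → y ≢ 2 + q → x + y ≢ 3 + (q + q)
x+y≢3+q+q {q} {x} {y} q<x q<y x≢2+q y≢2+q x+y≡ =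
  y≢2+q (+-cancelˡ-≡ (suc q) y (2 + q) (begin-equality
  suc q + y       ≡⟨ cong (_+ y) (sym x≡1+q) ⟩
  x + y           ≡⟨ x+y≡ ⟩
  3 + (q + q)     ≡⟨ cong suc (sym (trans (+-suc q (suc q)) (cong suc (+-suc q q)))) ⟩
  suc q + (2 + q) ∎))
  where
  x≤2+q : x ≤ 2 + q
  x≤2+q = +-cancelʳ-≤ (suc q) x (2 + q) (begin
    x + suc q       ≤⟨ +-monoʳ-≤ x q<y ⟩
    x + y           ≡⟨ x+y≡ ⟩
    3 + (q + q)     ≡⟨ cong (suc ∘ suc) (sym (+-suc q q)) ⟩
    2 + q + suc q   ∎)
  x≡1+q : x ≡ suc q
  x≡1+q = ≤-antisym (s≤s⁻¹ (≤∧≢⇒< x≤2+q x≢2+q)) q<x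

-- The partition (3, 2^q, 1^q): its numerical set is {0, q + 1} ∪ [2q + 2, ∞) minus {2q + 3}.
padHook₂-semigroup : ∀ {q} → 1 ≤ q → SemigroupPartition (pad q (2 ∷ replicate q 1))
padHook₂-semigroup {q} 1≤q =
  (Sλ-0 la , _ , λ _ → pad-large⇒Sλ q _ (≤-refl ∷ All.replicate⁺ q (s≤s z≤n))) ,
  closure-from-nonzero sum∈S
  where
  la : List ℕ
  la = pad q (2 ∷ replicate q 1)
  la⁺ : Positive la
  la⁺ = pad-positive q (2 ∷ replicate q 1)
  above-q : ∀ {x} → 0 < x → Sλ la x → q < x
  above-q = above-gaps (λ x 1≤x x≤q → ∈⇒¬Sλ la⁺ (∈-pad-low _ 1≤x x≤q))
  q+2∉S : ∀ {x} → Sλ la x → x ≢ 2 + q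
  q+2∉S Sx refl = ∈⇒¬Sλ la⁺ (padHook-mid-∈ 1≤q) Sx
  sum∉ : ∀ {x y} → q < x → q < y → x ≢ 2 + q → y ≢ 2 + q → x + y ∉ firstColumnHooks la
  sum∉ {x} {y} q<x q<y x≢2+q y≢2+q x+y∈ with ∈-padHook⁻ x+y∈
  ... | inj₁ top = x+y≢3+q+q q<x q<y x≢2+q y≢2+q top
  ... | inj₂ (inj₁ (j , j<q , mid)) = <-irrefl (sym mid) (begin-strict
    2 + j + q           <⟨ s≤s (s≤s (+-monoˡ-< q j<q)) ⟩
    2 + (q + q)         ≡⟨ cong suc (sym (+-suc q q)) ⟩
    suc q + suc q       ≤⟨ +-mono-≤ q<x q<y ⟩
    x + y               ∎)
  ... | inj₂ (inj₂ low) = n≮n q (<-≤-trans q<x (≤-trans (m≤m+n x y) low))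
  sum∈S : ∀ x y → 0 < x → 0 < y → Sλ la x → Sλ la y → Sλ la (x + y)
  sum∈S x y 0<x 0<y Sx Sy =
    ∉⇒Sλ la⁺ (sum∉ (above-q 0<x Sx) (above-q 0<y Sy) (q+2∉S Sx) (q+2∉S Sy))

hookPartition : ℕ → ℕ → List ℕ
hookPartition n a = a ∷ replicate (n ∸ a) 1

hookPartition-isPartition : ∀ {n a} → 1 ≤ a → a ≤ n → IsPartitionOf n (hookPartition n a)
hookPartition-isPartition {n} {suc a} 1≤a a≤n =
  1≤a ∷ All.replicate⁺ (n ∸ suc a) (s≤s z≤n) ,
  pad-sorted (n ∸ suc a) {a ∷ []} [-] ,  -- (a + 1, 1^p) is pad p (a)
  trans (cong (suc a +_) (sum-ones (n ∸ suc a))) (m+[n∸m]≡n a≤n)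

addColumn-hookPartition : ∀ {n g a} → 1 ≤ a → a ≤ n → n ≤ g →
  Σ ℕ λ p → Σ ℕ λ r → a + p ≡ n × suc (p + r) ≡ g ×
                      addColumn g (hookPartition n a) ≡ pad r (a ∷ replicate p 1)
addColumn-hookPartition {n} {g} {a} 1≤a a≤n n≤g =
  n ∸ a , g ∸ suc (n ∸ a) , m+[n∸m]≡n a≤n , m+[n∸m]≡n 1+p≤g ,
  cong (λ k → pad (g ∸ suc k) (hookPartition n a)) (length-replicate (n ∸ a))
  where
  1+p≤g : suc (n ∸ a) ≤ g
  1+p≤g = ≤-trans (subst (suc (n ∸ a) ≤_) (m+[n∸m]≡n a≤n) (+-monoˡ-≤ (n ∸ a) 1≤a)) n≤g

hook-semigroup : ∀ {n g a} → 1 ≤ a → a ≤ n → n ≤ g → n + n < g + a →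
                 SemigroupPartition (addColumn g (hookPartition n a))
hook-semigroup {a = a} 1≤a a≤n n≤g wide
  with p , r , refl , refl , e ← addColumn-hookPartition 1≤a a≤n n≤g =
  subst SemigroupPartition (sym e) (padHook-semigroup 1≤a (+-cancelˡ-≤ (p + a) (a + p) r (begin
    p + a + (a + p) ≡⟨ cong (_+ (a + p)) (+-comm p a) ⟩
    a + p + (a + p) ≤⟨ s≤s⁻¹ wide ⟩
    p + r + a       ≡⟨ solve (p List.∷ r List.∷ a List.∷ List.[]) ⟩
    p + a + r       ∎)))

hook-not-semigroup : ∀ {n g a} → 1 ≤ a → a ≤ n → n ≤ g →
                     g + a ≡ n + n ⊎ g + (a + a) ≤ n + n →
                     ¬ SemigroupPartition (addColumn g (hookPartition n a))
hook-not-semigroup {a = a} 1≤a a≤n n≤g top-or-mid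
  with p , r , refl , refl , e ← addColumn-hookPartition 1≤a a≤n n≤g =
  padHook-not-semigroup 1≤a (Sum.map top mid top-or-mid) ∘ subst SemigroupPartition e
  where
  top : suc (p + r) + a ≡ a + p + (a + p) → a + p ≡ suc r
  top eq = sym (+-cancelˡ-≡ (p + a) (suc r) (a + p) (begin-equality
    p + a + suc r   ≡⟨ solve (p List.∷ a List.∷ r List.∷ List.[]) ⟩
    suc (p + r) + a ≡⟨ eq ⟩
    a + p + (a + p) ≡⟨ cong (_+ (a + p)) (+-comm a p) ⟩
    p + a + (a + p) ∎))
  mid : suc (p + r) + (a + a) ≤ a + p + (a + p) → r < p
  mid le = +-cancelˡ-≤ (a + a + p) (suc r) p (begin
    a + a + p + suc r     ≡⟨ solve (a List.∷ p List.∷ r List.∷ List.[]) ⟩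
    suc (p + r) + (a + a) ≤⟨ le ⟩
    a + p + (a + p)       ≡⟨ solve (a List.∷ p List.∷ List.[]) ⟩
    a + a + p + p         ∎)

hook₂-semigroup : ∀ {n g} → 3 ≤ n → n ≤ g → g + 3 ≡ n + n →
                  SemigroupPartition (addColumn g (hookPartition n 2))
hook₂-semigroup 3≤n n≤g g+3≡n+n
  with p , r , refl , refl , e ← addColumn-hookPartition (s≤s z≤n) (≤-trans (n≤1+n 2) 3≤n) n≤g =
  subst SemigroupPartition (sym e)
    (subst (λ k → SemigroupPartition (pad k (2 ∷ replicate p 1))) (sym r≡p)
           (padHook₂-semigroup (s≤s⁻¹ (s≤s⁻¹ 3≤n))))
  where
  r≡p : r ≡ p
  r≡p = +-cancelˡ-≡ (4 + p) r p (begin-equality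
    4 + p + r         ≡⟨ solve (p List.∷ r List.∷ List.[]) ⟩
    suc (p + r) + 3   ≡⟨ g+3≡n+n ⟩
    2 + p + (2 + p)   ≡⟨ solve (p List.∷ List.[]) ⟩
    4 + p + p         ∎)

ones-or-excess : ∀ {xs} → Positive xs → xs ≡ replicate (length xs) 1 ⊎ length xs < sum xs
ones-or-excess [] = inj₁ refl
ones-or-excess {suc zero ∷ xs} (_ ∷ xs⁺) with ones-or-excess xs⁺
... | inj₁ ones   = inj₁ (cong (1 ∷_) ones)
... | inj₂ excess = inj₂ (s≤s excess)
ones-or-excess {suc (suc x) ∷ xs} (_ ∷ xs⁺) =
  inj₂ (s≤s (s≤s (≤-trans (length≤sum xs⁺) (m≤n+m _ x))))

hookPartition-of-ones : ∀ {x xs} → xs ≡ replicate (length xs) 1 →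
                        x ∷ xs ≡ hookPartition (x + sum xs) x
hookPartition-of-ones {x} {xs} ones =
  cong (x ∷_) (trans ones (cong (λ k → replicate k 1) (sym tail-length)))
  where
  tail-length : x + sum xs ∸ x ≡ length xs
  tail-length = trans (m+n∸m≡n x (sum xs)) (trans (cong sum ones) (sum-ones (length xs)))

hook-or-thin : ∀ {n x xs} → IsPartitionOf n (x ∷ xs) →
  (x ∷ xs ≡ hookPartition n x × 1 ≤ x × x ≤ n) ⊎ (2 ≤ x × x + length (x ∷ xs) ≤ n)
hook-or-thin {x = suc zero} {xs} (_ ∷ xs⁺ , sorted , refl) =
  inj₁ (hookPartition-of-ones (≤1-ones xs⁺ (All.tail (sorted-bounded sorted))) ,
        ≤-refl , m≤m+n 1 (sum xs))
hook-or-thin {x = suc (suc x)} {xs} (_ ∷ xs⁺ , _ , refl) with ones-or-excess xs⁺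
... | inj₁ ones   = inj₁ (hookPartition-of-ones ones , s≤s z≤n , m≤m+n (2 + x) (sum xs))
... | inj₂ excess = inj₂ (s≤s (s≤s z≤n) , +-monoʳ-≤ (2 + x) excess)

addColumn-semigroup : ∀ {g x xs} → Linked _≥_ (x ∷ xs) → length (x ∷ xs) ≤ g →
  x + (length (x ∷ xs) + length (x ∷ xs)) ≤ suc g → SemigroupPartition (addColumn g (x ∷ xs))
addColumn-semigroup {g} {x} {xs} sorted k≤g fits = pad-semigroup (g ∸ k) (x ∷ xs) (sorted-bounded sorted)
  (subst (x + k ≤_) (+-∸-assoc 1 k≤g)
         (m+n≤o⇒m≤o∸n (x + k) (subst (_≤ suc g) (sym (+-assoc x k k)) fits)))
  where
  k : ℕ
  k = length (x ∷ xs)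

thin-fits : ∀ {x k n g} → 2 ≤ x → x + k ≤ n → n + n ≤ g + 3 → x + (k + k) ≤ suc g
thin-fits {x} {k} {n} {g} 2≤x thin narrow = +-cancelˡ-≤ 2 _ _ (begin
  2 + (x + (k + k)) ≤⟨ +-monoˡ-≤ (x + (k + k)) 2≤x ⟩
  x + (x + (k + k)) ≡⟨ solve (x List.∷ k List.∷ List.[]) ⟩
  x + k + (x + k)   ≤⟨ +-mono-≤ thin thin ⟩
  n + n             ≤⟨ narrow ⟩
  g + 3             ≡⟨ +-comm g 3 ⟩
  2 + suc g         ∎)

smallHook-or-semigroup : ∀ {n g μ} → IsPartitionOf n μ → n ≤ g → n + n ≤ g + 3 →
  μ ≡ hookPartition n 1 ⊎ μ ≡ hookPartition n 2 ⊎ μ ≡ hookPartition n 3 ⊎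
  SemigroupPartition (addColumn g μ)
smallHook-or-semigroup {g = g} {[]} _ _ _ = inj₂ (inj₂ (inj₂ (pad-semigroup g [] [] z≤n)))
smallHook-or-semigroup {n} {g} {x ∷ xs} π@(x⁺ ∷ xs⁺ , sorted , sum≡n) n≤g narrow
  with hook-or-thin π
... | inj₂ (2≤x , thin) =
  inj₂ (inj₂ (inj₂ (addColumn-semigroup sorted k≤g (thin-fits 2≤x thin narrow))))
  where
  k≤g : length (x ∷ xs) ≤ g
  k≤g = ≤-trans (length≤sum (x⁺ ∷ xs⁺)) (≤-trans (≤-reflexive sum≡n) n≤g)
... | inj₁ (hook , 1≤x , x≤n) = by-head x hook 1≤x x≤n
  where
  by-head : ∀ a → x ∷ xs ≡ hookPartition n a → 1 ≤ a → a ≤ n →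
    x ∷ xs ≡ hookPartition n 1 ⊎ x ∷ xs ≡ hookPartition n 2 ⊎ x ∷ xs ≡ hookPartition n 3 ⊎
    SemigroupPartition (addColumn g (x ∷ xs))
  by-head 1 hook _ _ = inj₁ hook
  by-head 2 hook _ _ = inj₂ (inj₁ hook)
  by-head 3 hook _ _ = inj₂ (inj₂ (inj₁ hook))
  by-head (suc (suc (suc (suc a)))) hook 1≤a a≤n = inj₂ (inj₂ (inj₂
    (subst (SemigroupPartition ∘ addColumn g) (sym hook) (hook-semigroup 1≤a a≤n n≤g wide))))
    where
    wide : n + n < g + (4 + a)
    wide = ≤-trans (s≤s narrow) (≤-trans (≤-reflexive (sym (+-suc g 3))) (+-monoʳ-≤ g (m≤m+n 4 a)))

HasCount-cong : ∀ {P Q : List ℕ → Set} {k} → (∀ x → P x ⇔ Q x) → HasCount P k → HasCount Q k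
HasCount-cong P⇔Q (L , u , mem , len) = L , u , (λ x → ⇔-trans (mem x) (P⇔Q x)) , len

map⁺-unique : ∀ (f : List ℕ → List ℕ) {L} →
  (∀ {x y} → x ∈ L → y ∈ L → f x ≡ f y → x ≡ y) → Unique L → Unique (map f L)
map⁺-unique f {[]} _ [] = []
map⁺-unique f {x ∷ L} inj (x∉ ∷ u) =
  All.map⁺ (All.tabulate λ y∈ fx≡fy → All.lookup x∉ y∈ (inj (here refl) (there y∈) fx≡fy))
  ∷ map⁺-unique f (λ x∈ y∈ → inj (there x∈) (there y∈)) u

HasCount-bijection : ∀ {P Q : List ℕ → Set} {k} (f f⁻¹ : List ℕ → List ℕ) →
  (∀ {x} → P x → Q (f x)) → (∀ {y} → Q y → P (f⁻¹ y)) →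
  (∀ {x} → P x → f⁻¹ (f x) ≡ x) → (∀ {y} → Q y → f (f⁻¹ y) ≡ y) →
  HasCount P k → HasCount Q k
HasCount-bijection {P} {Q} f f⁻¹ f-Q f⁻¹-P inverseˡ inverseʳ (L , u , mem , refl) =
  map f L , map⁺-unique f injective u , (λ y → mk⇔ sound (complete y)) , length-map f L
  where
  injective : ∀ {x y} → x ∈ L → y ∈ L → f x ≡ f y → x ≡ y
  injective {x} {y} x∈ y∈ fx≡fy =
    trans (sym (inverseˡ (to (mem x) x∈))) (trans (cong f⁻¹ fx≡fy) (inverseˡ (to (mem y) y∈)))
  sound : ∀ {y} → y ∈ map f L → Q y
  sound y∈ with x , x∈ , refl ← ∈-map⁻ f y∈ = f-Q (to (mem x) x∈)
  complete : ∀ y → Q y → y ∈ map f L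
  complete y Qy = subst (_∈ map f L) (inverseʳ Qy) (∈-map⁺ f (from (mem (f⁻¹ y)) (f⁻¹-P Qy)))

_≟ₗ_ : DecidableEquality (List ℕ)
_≟ₗ_ = ≡-dec _≟_

length-filter-≢ : ∀ {b} L → Unique L → b ∈ L →
                  suc (length (filter (λ x → ¬? (x ≟ₗ b)) L)) ≡ length L
length-filter-≢ {b} (x ∷ L) (x∉ ∷ _) (here refl) = cong suc (trans
  (cong length (filter-reject (λ y → ¬? (y ≟ₗ b)) (λ x≢x → x≢x refl)))
  (cong length (filter-all (λ y → ¬? (y ≟ₗ b)) (All.map ≢-sym x∉))))
length-filter-≢ {b} (x ∷ L) (x∉ ∷ u) (there b∈) = cong suc (trans
  (cong length (filter-accept (λ y → ¬? (y ≟ₗ b)) (All.lookup x∉ b∈)))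
  (length-filter-≢ L u b∈))

HasCount-remove : ∀ {P : List ℕ → Set} {k b} → P b → HasCount P k →
                  HasCount (λ x → P x × x ≢ b) (k ∸ 1)
HasCount-remove {P} {b = b} Pb (L , u , mem , refl) =
  filter ≢b? L , Unique.filter⁺ ≢b? u , (λ x → mk⇔ sound complete) ,
  cong (_∸ 1) (length-filter-≢ L u (from (mem b) Pb))
  where
  ≢b? : (x : List ℕ) → Dec (x ≢ b)
  ≢b? x = ¬? (x ≟ₗ b)
  sound : ∀ {x} → x ∈ filter ≢b? L → P x × x ≢ b
  sound x∈ with x∈L , x≢b ← ∈-filter⁻ ≢b? x∈ = to (mem _) x∈L , x≢b
  complete : ∀ {x} → P x × x ≢ b → x ∈ filter ≢b? L
  complete (Px , x≢b) = ∈-filter⁺ ≢b? (from (mem _) Px) x≢b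

HasCount-removeAll : ∀ {P : List ℕ → Set} {k} bad → Unique bad → All P bad → HasCount P k →
                     HasCount (λ x → P x × x ∉ bad) (k ∸ length bad)
HasCount-removeAll [] _ _ count = HasCount-cong (λ _ → mk⇔ (_, λ ()) proj₁) count
HasCount-removeAll {k = k} (b ∷ bad) (b∉ ∷ u) (Pb ∷ Pbad) count =
  subst (HasCount _) (∸-+-assoc k 1 (length bad))
    (HasCount-cong (λ _ → mk⇔
        (λ ((Px , x≢b) , x∉) → Px , λ { (here x≡b) → x≢b x≡b ; (there x∈) → x∉ x∈ })
        (λ (Px , x∉) → (Px , x∉ ∘ here) , x∉ ∘ there))
      (HasCount-removeAll bad u (All.zip (Pbad , All.map ≢-sym b∉)) (HasCount-remove Pb count)))

addColumn-counts : ∀ {n g k} → n ≤ g →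
  HasCount (λ μ → IsPartitionOf n μ × SemigroupPartition (addColumn g μ)) k →
  HasCount (IsPG (n + g) g) k
addColumn-counts {n} {g} n≤g = HasCount-bijection (addColumn g) removeColumn
  (λ {μ} (π , sg) → addColumn-isPartition π (length≤g π) ,
                    length-addColumn {μ = μ} (length≤g π) , sg)
  (λ (π , ℓ≡g , sg) → removeColumn-isPartition π ℓ≡g ,
                      subst SemigroupPartition (sym (inverse π ℓ≡g)) sg)
  (λ {μ} ((μ⁺ , _) , _) → removeColumn-pad (g ∸ length μ) μ⁺)
  (λ (π , ℓ≡g , _) → inverse π ℓ≡g)
  where
  length≤g : ∀ {μ} → IsPartitionOf n μ → length μ ≤ g
  length≤g (μ⁺ , _ , sum≡n) = ≤-trans (length≤sum μ⁺) (≤-trans (≤-reflexive sum≡n) n≤g)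
  inverse : ∀ {la} → IsPartitionOf (n + g) la → length la ≡ g → addColumn g (removeColumn la) ≡ la
  inverse {la} (la⁺ , sorted , _) ℓ≡g =
    subst (λ h → addColumn h (removeColumn la) ≡ la) ℓ≡g (addColumn-removeColumn la⁺ sorted)

-- The column heights g = 2n − 1, 2n − 2, 2n − 3

semigroup⇔∉-2n∸1 : ∀ {n g μ} → 3 ≤ n → n ≤ g → g + 1 ≡ n + n → IsPartitionOf n μ →
  SemigroupPartition (addColumn g μ) ⇔ μ ∉ hookPartition n 1 ∷ []
semigroup⇔∉-2n∸1 {n} {g} 3≤n n≤g g+1≡n+n π = mk⇔
  (λ { sg (here refl) → hook-not-semigroup ≤-refl 1≤n n≤g (inj₁ g+1≡n+n) sg
     ; _ (there ()) })
  (λ μ∉ → case smallHook-or-semigroup π n≤g n+n≤g+3 of λ where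
    (inj₁ μ≡H₁)               → ⊥-elim (μ∉ (here μ≡H₁))
    (inj₂ (inj₁ refl))        →
      hook-semigroup (s≤s z≤n) 2≤n n≤g (subst (_< g + 2) g+1≡n+n (+-monoʳ-< g ≤-refl))
    (inj₂ (inj₂ (inj₁ refl))) →
      hook-semigroup (s≤s z≤n) 3≤n n≤g (subst (_< g + 3) g+1≡n+n (+-monoʳ-< g (n≤1+n 2)))
    (inj₂ (inj₂ (inj₂ sg)))   → sg)
  where
  2≤n : 2 ≤ n
  2≤n = ≤-trans (n≤1+n 2) 3≤n
  1≤n : 1 ≤ n
  1≤n = ≤-trans (n≤1+n 1) 2≤n
  n+n≤g+3 : n + n ≤ g + 3
  n+n≤g+3 = subst (_≤ g + 3) g+1≡n+n (+-monoʳ-≤ g (s≤s z≤n))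

semigroup⇔∉-2n∸2 : ∀ {n g μ} → 3 ≤ n → n ≤ g → g + 2 ≡ n + n → IsPartitionOf n μ →
  SemigroupPartition (addColumn g μ) ⇔ μ ∉ hookPartition n 1 ∷ hookPartition n 2 ∷ []
semigroup⇔∉-2n∸2 {n} {g} 3≤n n≤g g+2≡n+n π = mk⇔
  (λ { sg (here refl)         → hook-not-semigroup ≤-refl 1≤n n≤g (inj₂ (≤-reflexive g+2≡n+n)) sg
     ; sg (there (here refl)) → hook-not-semigroup (s≤s z≤n) 2≤n n≤g (inj₁ g+2≡n+n) sg
     ; _ (there (there ())) })
  (λ μ∉ → case smallHook-or-semigroup π n≤g n+n≤g+3 of λ where
    (inj₁ μ≡H₁)               → ⊥-elim (μ∉ (here μ≡H₁))
    (inj₂ (inj₁ μ≡H₂))        → ⊥-elim (μ∉ (there (here μ≡H₂)))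
    (inj₂ (inj₂ (inj₁ refl))) →
      hook-semigroup (s≤s z≤n) 3≤n n≤g (subst (_< g + 3) g+2≡n+n (+-monoʳ-< g ≤-refl))
    (inj₂ (inj₂ (inj₂ sg)))   → sg)
  where
  2≤n : 2 ≤ n
  2≤n = ≤-trans (n≤1+n 2) 3≤n
  1≤n : 1 ≤ n
  1≤n = ≤-trans (n≤1+n 1) 2≤n
  n+n≤g+3 : n + n ≤ g + 3
  n+n≤g+3 = subst (_≤ g + 3) g+2≡n+n (+-monoʳ-≤ g (n≤1+n 2))

semigroup⇔∉-2n∸3 : ∀ {n g μ} → 3 ≤ n → n ≤ g → g + 3 ≡ n + n → IsPartitionOf n μ →
  SemigroupPartition (addColumn g μ) ⇔ μ ∉ hookPartition n 1 ∷ hookPartition n 3 ∷ []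
semigroup⇔∉-2n∸3 {n} {g} 3≤n n≤g g+3≡n+n π = mk⇔
  (λ { sg (here refl)         → hook-not-semigroup ≤-refl 1≤n n≤g (inj₂ g+2≤n+n) sg
     ; sg (there (here refl)) → hook-not-semigroup (s≤s z≤n) 3≤n n≤g (inj₁ g+3≡n+n) sg
     ; _ (there (there ())) })
  (λ μ∉ → case smallHook-or-semigroup π n≤g (≤-reflexive (sym g+3≡n+n)) of λ where
    (inj₁ μ≡H₁)               → ⊥-elim (μ∉ (here μ≡H₁))
    (inj₂ (inj₁ refl))        → hook₂-semigroup 3≤n n≤g g+3≡n+n
    (inj₂ (inj₂ (inj₁ μ≡H₃))) → ⊥-elim (μ∉ (there (here μ≡H₃)))
    (inj₂ (inj₂ (inj₂ sg)))   → sg)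
  where
  1≤n : 1 ≤ n
  1≤n = ≤-trans (s≤s z≤n) 3≤n
  g+2≤n+n : g + 2 ≤ n + n
  g+2≤n+n = subst (g + 2 ≤_) g+3≡n+n (+-monoʳ-≤ g (n≤1+n 2))

PG-count : ∀ {n p} j (bad : List (List ℕ)) → j ≤ n → Unique bad → All (IsPartitionOf n) bad →
  (∀ {g μ} → n ≤ g → g + j ≡ n + n → IsPartitionOf n μ →
             SemigroupPartition (addColumn g μ) ⇔ μ ∉ bad) →
  HasCount (IsPartitionOf n) p → HasCount (IsPG (3 * n ∸ j) (2 * n ∸ j)) (p ∸ length bad)
PG-count {n} {p} j bad j≤n unique bad-partitions semigroup⇔∉ =
  subst (λ N → HasCount (IsPG N g) (p ∸ length bad)) (sym (+-∸-assoc n j≤2n))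
  ∘ addColumn-counts n≤g
  ∘ HasCount-cong (λ μ → mk⇔ (λ (π , μ∉) → π , from (semigroup⇔∉ n≤g g+j≡n+n π) μ∉)
                             (λ (π , sg) → π , to (semigroup⇔∉ n≤g g+j≡n+n π) sg))
  ∘ HasCount-removeAll bad unique bad-partitions
  where
  g : ℕ
  g = 2 * n ∸ j
  j≤2n : j ≤ 2 * n
  j≤2n = ≤-trans j≤n (m≤m+n n _)
  g+j≡n+n : g + j ≡ n + n
  g+j≡n+n = trans (m∸n+n≡m j≤2n) (cong (n +_) (+-identityʳ n))
  n≤g : n ≤ g
  n≤g = +-cancelʳ-≤ j n g (subst (n + j ≤_) (sym g+j≡n+n) (+-monoʳ-≤ n j≤n))

theorem3p2 : ∀ (n : ℕ) → 3 ≤ n → ∀ (p : ℕ) → HasCount (IsPartitionOf n) p →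
    HasCount (IsPG (3 * n ∸ 1) (2 * n ∸ 1)) (p ∸ 1)
    × HasCount (IsPG (3 * n ∸ 2) (2 * n ∸ 2)) (p ∸ 2)
    × HasCount (IsPG (3 * n ∸ 3) (2 * n ∸ 3)) (p ∸ 2)
theorem3p2 n 3≤n p partitions =
  PG-count 1 (H 1 ∷ []) 1≤n ([] ∷ [])
    (H-partition ≤-refl 1≤n ∷ [])
    (semigroup⇔∉-2n∸1 3≤n) partitions ,
  PG-count 2 (H 1 ∷ H 2 ∷ []) 2≤n (((λ ()) ∷ []) ∷ [] ∷ [])
    (H-partition ≤-refl 1≤n ∷ H-partition (s≤s z≤n) 2≤n ∷ [])
    (semigroup⇔∉-2n∸2 3≤n) partitions ,
  PG-count 3 (H 1 ∷ H 3 ∷ []) 3≤n (((λ ()) ∷ []) ∷ [] ∷ [])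
    (H-partition ≤-refl 1≤n ∷ H-partition (s≤s z≤n) 3≤n ∷ [])
    (semigroup⇔∉-2n∸3 3≤n) partitions
  where
  H : ℕ → List ℕ
  H = hookPartition n
  H-partition : ∀ {a} → 1 ≤ a → a ≤ n → IsPartitionOf n (H a)
  H-partition = hookPartition-isPartition
  2≤n : 2 ≤ n
  2≤n = ≤-trans (n≤1+n 2) 3≤n
  1≤n : 1 ≤ n
  1≤n = ≤-trans (n≤1+n 1) 2≤n
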